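{- Let $\mathcal M$ be a regular linear hypermap on the sphere with $m$ flags. Then $m\ge 12$ and the $\mathcal M$-sequence of $\mathcal M$ is one of $[0;3,2,3;4,6,4;24]$, $[0;2,3,3;6,4,4;24]$, $[0;3,2,4;8,12,6;48]$, $[0;2,3,4;12,8,6;48]$, $[0;4,2,3;6,12,8;48]$, $[0;2,4,3;12,6,8;48]$, $[0;3,2,5;20,30,12;120]$, $[0;2,3,5;30,20,12;120]$, $[0;5,2,3;12,30,20;120]$, $[0;2,5,3;30,12,20;120]$, $[0;2,2,\frac m4;\frac m4,\frac m4,2;m]$.
   Context: For a finite group $G$ and pairwise distinct involutions $r_0,r_1,r_2$ generating $G$, $\mathcal M(G;r_0,r_1,r_2)$ is a regular linear hypermap if (1) $\langle r_1,r_2\rangle\cap\langle r_0,r_2\rangle=\langle r_2\rangle$ and (2) $\langle r_1,r_2\rangle\langle r_0,r_2\rangle\cap\langle r_0,r_2\rangle\langle r_1,r_2\rangle=\langle r_1,r_2\rangle\cup\langle r_0,r_2\rangle$. Its flags are the elements of $G$ (so $m=|G|$); $V=|G|/|\langle r_1,r_2\rangle|$ vertices, $E=|G|/|\langle r_0,r_2\rangle|$ hyperedges, $F=|G|/|\langle r_0,r_1\rangle|$ hyperfaces; type $(k,m',n)=(|r_1r_2|,|r_0r_2|,|r_0r_1|)$ (valencies of vertices, hyperedges, hyperfaces). It is non-orientable if $G=\langle r_0r_2,r_1r_2\rangle$, orientable otherwise, with genus $g$ given by $V+E+F-|G|/2=2-2g$ (orientable) or $2-g$ (non-orientable); it lies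 on the sphere when it is orientable of genus $0$. The $\mathcal M$-sequence is $[g;k,m',n;V,E,F;|G|]$. -}

module Defs where

open import Level using (0ℓ)
open import Data.Nat using (ℕ; zero; suc; _+_; _*_; _<_; _≤_)
open import Data.List using (List; length)
open import Data.List.Membership.Propositional using (_∈_)
open import Data.List.Relation.Unary.Unique.Propositional using (Unique)
open import Data.Product using (Σ; ∃₂; _×_; _,_)
open import Data.Sum using (_⊎_)
open import Relation.Binary.PropositionalEquality using (_≡_; _≢_)
open import Relation.Nullary using (¬_)
open import Relation.Unary using (Pred; _∩_; _∪_; _≐_)
open import Algebra.Structures using (IsGroup)

record FiniteGroup : Set₁ where
  field
    Carrier           : Set
    _∙_               : Carrier → Carrier → Carrier
    ε                 : Carrier
    _⁻¹               : Carrier → Carrier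
    isGroup           : IsGroup _≡_ _∙_ ε _⁻¹
    elements          : List Carrier
    elements-unique   : Unique elements
    elements-complete : ∀ x → x ∈ elements

  order : ℕ
  order = length elements

module _ (G : FiniteGroup) where
  open FiniteGroup G

  data Gen (S : Pred Carrier 0ℓ) : Pred Carrier 0ℓ where
    gen  : ∀ {x} → S x → Gen S x
    unit : Gen S ε
    mul  : ∀ {x y} → Gen S x → Gen S y → Gen S (x ∙ y)
    inv  : ∀ {x} → Gen S x → Gen S (x ⁻¹)

  Gen₁ : Carrier → Pred Carrier 0ℓ
  Gen₁ a = Gen (λ x → x ≡ a)

  Gen₂ : Carrier → Carrier → Pred Carrier 0ℓ
  Gen₂ a b = Gen (λ x → x ≡ a ⊎ x ≡ b)

  Gen₃ : Carrier → Carrier → Carrier → Pred Carrier 0ℓ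
  Gen₃ a b c = Gen (λ x → x ≡ a ⊎ x ≡ b ⊎ x ≡ c)

  HasSize : Pred Carrier 0ℓ → ℕ → Set
  HasSize P k = Σ (List Carrier) λ xs →
    Unique xs × length xs ≡ k × (∀ x → (P x → x ∈ xs) × (x ∈ xs → P x))

  _·ˢ_ : Pred Carrier 0ℓ → Pred Carrier 0ℓ → Pred Carrier 0ℓ
  (H ·ˢ K) x = ∃₂ λ h k → H h × K k × x ≡ h ∙ k

  pow : Carrier → ℕ → Carrier
  pow x zero    = ε
  pow x (suc n) = x ∙ pow x n

  ElemOrder : Carrier → ℕ → Set
  ElemOrder x k = 0 < k × pow x k ≡ ε × (∀ j → 0 < j → j < k → pow x j ≢ ε)

  Involution : Carrier → Set
  Involution x = x ≢ ε × x ∙ x ≡ ε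

  IsRegularLinearHypermap : Carrier → Carrier → Carrier → Set
  IsRegularLinearHypermap r₀ r₁ r₂ =
    Involution r₀ × Involution r₁ × Involution r₂ ×
    r₀ ≢ r₁ × r₀ ≢ r₂ × r₁ ≢ r₂ ×
    (∀ x → Gen₃ r₀ r₁ r₂ x) ×
    ((Gen₂ r₁ r₂ ∩ Gen₂ r₀ r₂) ≐ Gen₁ r₂) ×
    (((Gen₂ r₁ r₂ ·ˢ Gen₂ r₀ r₂) ∩ (Gen₂ r₀ r₂ ·ˢ Gen₂ r₁ r₂)) ≐ (Gen₂ r₁ r₂ ∪ Gen₂ r₀ r₂))

  NonOrientable : Carrier → Carrier → Carrier → Set
  NonOrientable r₀ r₁ r₂ = ∀ x → Gen₂ (r₀ ∙ r₂) (r₁ ∙ r₂) x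

  Orientable : Carrier → Carrier → Carrier → Set
  Orientable r₀ r₁ r₂ = ¬ NonOrientable r₀ r₁ r₂

-- the M-sequence [0; k, m', n; V, E, F; m] (genus 0) is one of the listed ones
AllowedSphereSequence : (k m′ n V E F m : ℕ) → Set
AllowedSphereSequence k m′ n V E F m =
    S ≡ (3 , 2 , 3 , 4 , 6 , 4 , 24)
  ⊎ S ≡ (2 , 3 , 3 , 6 , 4 , 4 , 24)
  ⊎ S ≡ (3 , 2 , 4 , 8 , 12 , 6 , 48)
  ⊎ S ≡ (2 , 3 , 4 , 12 , 8 , 6 , 48)
  ⊎ S ≡ (4 , 2 , 3 , 6 , 12 , 8 , 48)
  ⊎ S ≡ (2 , 4 , 3 , 12 , 6 , 8 , 48)
  ⊎ S ≡ (3 , 2 , 5 , 20 , 30 , 12 , 120)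
  ⊎ S ≡ (2 , 3 , 5 , 30 , 20 , 12 , 120)
  ⊎ S ≡ (5 , 2 , 3 , 12 , 30 , 20 , 120)
  ⊎ S ≡ (2 , 5 , 3 , 30 , 12 , 20 , 120)
  ⊎ (k ≡ 2 × m′ ≡ 2 × 4 * n ≡ m × 4 * V ≡ m × 4 * E ≡ m × F ≡ 2)
  where
  S : ℕ × ℕ × ℕ × ℕ × ℕ × ℕ × ℕ
  S = (k , m′ , n , V , E , F , m)

{-# OPTIONS --safe #-}
-- The stabilisers ⟨r₁,r₂⟩, ⟨r₀,r₂⟩, ⟨r₀,r₁⟩ are dihedral of orders 2k, 2m′, 2n, so
-- V = m/2k, E = m/2m′, F = m/2n and the Euler relation reads m (1/k + 1/m′ + 1/n − 1) = 4.
-- Distinctness of the generators gives k, m′ ≥ 2, and linearity forbids r₀ r₁ = r₁ r₀, so n ≥ 3.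
-- Writing k = 2 + i, m′ = 2 + j, n = 2 + l, the relation becomes m d + 4 k m′ n = 4 m with
-- d = ij + jl + il + ijl; hence d < 4, m ≥ k m′ n ≥ 12 and m = 4 k m′ n / (4 − d).  The triples
-- with l ≥ 1 and d < 4 are i = j = 0 (the family [0; 2, 2, m/4; …]) and the ten Platonic ones.
module Submission where

open import Defs
open import Data.Nat using (ℕ; _+_; _*_; _≤_; zero; suc; _∸_; _<_; z≤n; s≤s; z<s; NonZero)
open import Data.Product using (_×_; _,_; _,′_; proj₁; proj₂)
open import Relation.Binary.PropositionalEquality
  using (_≡_; _≢_; refl; sym; trans; cong; cong₂; subst; module ≡-Reasoning)

open import Level using (0ℓ)
open import Algebra.Bundles using (Group)
open import Data.Nat.Properties
open import Data.Nat.DivMod using (_%_; _/_; m≡m%n+[m/n]*n; m%n<n; m*n/n≡m)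
open import Data.Nat.Tactic.RingSolver using (solve-∀)
open import Data.List using (List; _++_; map; applyUpTo; length)
open import Data.List.Properties using (length-++; length-map; length-applyUpTo)
open import Data.List.Membership.Propositional using (_∈_)
open import Data.List.Membership.Propositional.Properties
  using (∈-map⁺; ∈-map⁻; ∈-applyUpTo⁺; ∈-applyUpTo⁻; ∈-++⁺ˡ; ∈-++⁺ʳ; ∈-++⁻)
open import Data.List.Membership.Propositional.Properties.WithK using (unique∧set⇒bag)
open import Data.List.Relation.Binary.BagAndSetEquality using (∼bag⇒↭)
open import Data.List.Relation.Binary.Permutation.Propositional.Properties using (↭-length)
open import Data.List.Relation.Binary.Disjoint.Propositional using (Disjoint)
open import Data.List.Relation.Unary.Unique.Propositional using (Unique)
open import Data.List.Relation.Unary.Unique.Propositional.Properties using (applyUpTo⁺₁; map⁺; ++⁺)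
open import Data.Sum using (_⊎_; inj₁; inj₂; [_,_]′)
open import Data.Empty using (⊥-elim)
open import Function using (_∘_)
open import Function.Bundles using (mk⇔)
open import Relation.Nullary using (¬_)

HasSize-functional : ∀ (G : FiniteGroup) {P a b} → HasSize G P a → HasSize G P b → a ≡ b
HasSize-functional G (xs , xs! , refl , xs≐P) (ys , ys! , refl , ys≐P) =
  ↭-length (∼bag⇒↭ (unique∧set⇒bag xs! ys! (mk⇔ (λ x∈xs → proj₁ (ys≐P _) (proj₂ (xs≐P _) x∈xs))
                                                   (λ x∈ys → proj₁ (xs≐P _) (proj₂ (ys≐P _) x∈ys)))))

module GroupProperties (G : FiniteGroup) where
  open FiniteGroup G

  group : Group 0ℓ 0ℓ
  group = record { isGroup = isGroup }

  open Group group public using (assoc; identityˡ; identityʳ; inverseʳ)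
  open import Algebra.Properties.Group group public
    using (∙-cancelˡ; ∙-cancelʳ; inverseʳ-unique; identityˡ-unique; identityʳ-unique; ⁻¹-anti-homo-∙)
  open ≡-Reasoning

  infixr 30 _^_
  _^_ : Carrier → ℕ → Carrier
  w ^ i = pow G w i

  ^-+ : ∀ w i j → w ^ (i + j) ≡ w ^ i ∙ w ^ j
  ^-+ w zero    j = sym (identityˡ _)
  ^-+ w (suc i) j = trans (cong (w ∙_) (^-+ w i j)) (sym (assoc _ _ _))

  ε^ : ∀ j → ε ^ j ≡ ε
  ε^ zero    = refl
  ε^ (suc j) = trans (identityˡ _) (ε^ j)

  ^-* : ∀ w i j → w ^ (i * j) ≡ (w ^ j) ^ i
  ^-* w zero    j = refl
  ^-* w (suc i) j = trans (^-+ w j (i * j)) (cong (w ^ j ∙_) (^-* w i j))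

  ^-comm : ∀ w i → w ^ i ∙ w ≡ w ∙ w ^ i
  ^-comm w i = begin
    w ^ i ∙ w       ≡⟨ cong (w ^ i ∙_) (identityʳ w) ⟨
    w ^ i ∙ w ^ 1   ≡⟨ ^-+ w i 1 ⟨
    w ^ (i + 1)     ≡⟨ cong (w ^_) (+-comm i 1) ⟩
    w ∙ w ^ i       ∎

  module _ {w k} (w^k≡ε : w ^ k ≡ ε) where

    ^-*-order : ∀ i → w ^ (i * k) ≡ ε
    ^-*-order i = trans (^-* w i k) (trans (cong (_^ i) w^k≡ε) (ε^ i))

    ^-%-order : ∀ i .{{_ : NonZero k}} → w ^ i ≡ w ^ (i % k)
    ^-%-order i = begin
      w ^ i                          ≡⟨ cong (w ^_) (m≡m%n+[m/n]*n i k) ⟩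
      w ^ (i % k + i / k * k)        ≡⟨ ^-+ w (i % k) _ ⟩
      w ^ (i % k) ∙ w ^ (i / k * k)  ≡⟨ cong (w ^ (i % k) ∙_) (^-*-order (i / k)) ⟩
      w ^ (i % k) ∙ ε                ≡⟨ identityʳ _ ⟩
      w ^ (i % k)                    ∎

  ^-involution : ∀ {w} → w ∙ w ≡ ε → ∀ i → w ^ i ≡ ε ⊎ w ^ i ≡ w
  ^-involution w∙w≡ε zero = inj₁ refl
  ^-involution w∙w≡ε (suc i) with ^-involution w∙w≡ε i
  ... | inj₁ wⁱ≡ε = inj₂ (trans (cong (_ ∙_) wⁱ≡ε) (identityʳ _))
  ... | inj₂ wⁱ≡w = inj₁ (trans (cong (_ ∙_) wⁱ≡w) w∙w≡ε)

  involution⁻¹ : ∀ {w} → w ∙ w ≡ ε → w ⁻¹ ≡ w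
  involution⁻¹ {w} w∙w≡ε = sym (inverseʳ-unique w w w∙w≡ε)

  involution-cancelʳ : ∀ {w v} → v ∙ v ≡ ε → (w ∙ v) ∙ v ≡ w
  involution-cancelʳ {w} {v} v∙v≡ε = trans (assoc w v v) (trans (cong (w ∙_) v∙v≡ε) (identityʳ w))

  involution-cancelˡ : ∀ {w v} → w ∙ w ≡ ε → w ∙ (w ∙ v) ≡ v
  involution-cancelˡ {w} {v} w∙w≡ε = trans (sym (assoc w w v)) (trans (cong (_∙ v) w∙w≡ε) (identityˡ v))

module _ (G : FiniteGroup) where
  open FiniteGroup G
  open GroupProperties G

  module Dihedral {x y : Carrier} (x≢ε : x ≢ ε) (x∙x≡ε : x ∙ x ≡ ε) (y≢ε : y ≢ ε) (y∙y≡ε : y ∙ y ≡ ε)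
    {t : ℕ} (z^k≡ε : (x ∙ y) ^ suc t ≡ ε) (z-minimal : ∀ j → 0 < j → j < suc t → (x ∙ y) ^ j ≢ ε)
    where

    open ≡-Reasoning

    z : Carrier
    z = x ∙ y

    z⁻¹≡zᵗ : z ⁻¹ ≡ z ^ t
    z⁻¹≡zᵗ = sym (inverseʳ-unique z (z ^ t) z^k≡ε)

    y∙z≡z⁻¹∙y : y ∙ z ≡ (z ⁻¹) ∙ y
    y∙z≡z⁻¹∙y = begin
      y ∙ (x ∙ y)            ≡⟨ assoc y x y ⟨
      (y ∙ x) ∙ y            ≡⟨ cong₂ (λ u v → (u ∙ v) ∙ y) (involution⁻¹ y∙y≡ε) (involution⁻¹ x∙x≡ε) ⟨
      ((y ⁻¹) ∙ (x ⁻¹)) ∙ y  ≡⟨ cong (_∙ y) (⁻¹-anti-homo-∙ x y) ⟨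
      (z ⁻¹) ∙ y             ∎

    y∙zʲ≡zʲᵗ∙y : ∀ j → y ∙ z ^ j ≡ z ^ (j * t) ∙ y
    y∙zʲ≡zʲᵗ∙y zero    = trans (identityʳ y) (sym (identityˡ y))
    y∙zʲ≡zʲᵗ∙y (suc j) = begin
      y ∙ (z ∙ z ^ j)               ≡⟨ assoc y z _ ⟨
      (y ∙ z) ∙ z ^ j               ≡⟨ cong (_∙ z ^ j) y∙z≡z⁻¹∙y ⟩
      ((z ⁻¹) ∙ y) ∙ z ^ j          ≡⟨ assoc _ y _ ⟩
      (z ⁻¹) ∙ (y ∙ z ^ j)          ≡⟨ cong₂ _∙_ z⁻¹≡zᵗ (y∙zʲ≡zʲᵗ∙y j) ⟩
      z ^ t ∙ (z ^ (j * t) ∙ y)     ≡⟨ assoc _ _ y ⟨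
      (z ^ t ∙ z ^ (j * t)) ∙ y     ≡⟨ cong (_∙ y) (^-+ z t (j * t)) ⟨
      z ^ (t + j * t) ∙ y           ∎

    zⁱ∙zⁱᵗ≡ε : ∀ i → z ^ i ∙ z ^ (i * t) ≡ ε
    zⁱ∙zⁱᵗ≡ε i = begin
      z ^ i ∙ z ^ (i * t)  ≡⟨ ^-+ z i (i * t) ⟨
      z ^ (i + i * t)      ≡⟨ cong (z ^_) (*-suc i t) ⟨
      z ^ (i * suc t)      ≡⟨ ^-*-order z^k≡ε i ⟩
      ε                    ∎

    rotation∙reflection : ∀ i j → z ^ i ∙ (z ^ j ∙ y) ≡ z ^ (i + j) ∙ y
    rotation∙reflection i j = trans (sym (assoc _ _ y)) (cong (_∙ y) (sym (^-+ z i j)))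

    reflection∙rotation : ∀ i j → (z ^ i ∙ y) ∙ z ^ j ≡ z ^ (i + j * t) ∙ y
    reflection∙rotation i j = begin
      (z ^ i ∙ y) ∙ z ^ j            ≡⟨ assoc _ y _ ⟩
      z ^ i ∙ (y ∙ z ^ j)            ≡⟨ cong (z ^ i ∙_) (y∙zʲ≡zʲᵗ∙y j) ⟩
      z ^ i ∙ (z ^ (j * t) ∙ y)      ≡⟨ rotation∙reflection i (j * t) ⟩
      z ^ (i + j * t) ∙ y            ∎

    reflection∙reflection : ∀ i j → (z ^ i ∙ y) ∙ (z ^ j ∙ y) ≡ z ^ (i + j * t)
    reflection∙reflection i j = begin
      (z ^ i ∙ y) ∙ (z ^ j ∙ y)      ≡⟨ assoc _ _ y ⟨
      ((z ^ i ∙ y) ∙ z ^ j) ∙ y      ≡⟨ cong (_∙ y) (reflection∙rotation i j) ⟩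
      (z ^ (i + j * t) ∙ y) ∙ y      ≡⟨ assoc _ y y ⟩
      z ^ (i + j * t) ∙ (y ∙ y)      ≡⟨ cong (z ^ (i + j * t) ∙_) y∙y≡ε ⟩
      z ^ (i + j * t) ∙ ε            ≡⟨ identityʳ _ ⟩
      z ^ (i + j * t)                ∎

    data NormalForm (w : Carrier) : Set where
      rotation   : ∀ i → w ≡ z ^ i → NormalForm w
      reflection : ∀ i → w ≡ z ^ i ∙ y → NormalForm w

    normal-form : ∀ {w} → Gen₂ G x y w → NormalForm w
    normal-form (gen (inj₁ refl)) = reflection 1 (begin
      x                  ≡⟨ identityʳ x ⟨
      x ∙ ε              ≡⟨ cong (x ∙_) y∙y≡ε ⟨
      x ∙ (y ∙ y)        ≡⟨ assoc x y y ⟨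
      z ∙ y              ≡⟨ cong (_∙ y) (identityʳ z) ⟨
      (z ∙ ε) ∙ y        ∎)
    normal-form (gen (inj₂ refl)) = reflection 0 (sym (identityˡ y))
    normal-form unit              = rotation 0 refl
    normal-form (mul a b) with normal-form a | normal-form b
    ... | rotation i refl   | rotation j refl   = rotation (i + j) (sym (^-+ z i j))
    ... | rotation i refl   | reflection j refl = reflection (i + j) (rotation∙reflection i j)
    ... | reflection i refl | rotation j refl   = reflection (i + j * t) (reflection∙rotation i j)
    ... | reflection i refl | reflection j refl = rotation (i + j * t) (reflection∙reflection i j)
    normal-form (inv a) with normal-form a
    ... | rotation i refl   = rotation (i * t) (sym (inverseʳ-unique _ _ (zⁱ∙zⁱᵗ≡ε i)))
    ... | reflection i refl = reflection i (sym (inverseʳ-unique _ _ reflection²≡ε))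
      where
      reflection²≡ε : (z ^ i ∙ y) ∙ (z ^ i ∙ y) ≡ ε
      reflection²≡ε = trans (reflection∙reflection i i) (trans (^-+ z i (i * t)) (zⁱ∙zⁱᵗ≡ε i))

    rotations reflections : List Carrier
    rotations   = applyUpTo (z ^_) (suc t)
    reflections = map (_∙ y) rotations

    z^∈rotations : ∀ i → z ^ i ∈ rotations
    z^∈rotations i = subst (_∈ rotations) (sym (^-%-order z^k≡ε i)) (∈-applyUpTo⁺ (z ^_) (m%n<n i (suc t)))

    normal-form-∈ : ∀ {w} → NormalForm w → w ∈ rotations ++ reflections
    normal-form-∈ (rotation i refl)   = ∈-++⁺ˡ (z^∈rotations i)
    normal-form-∈ (reflection i refl) = ∈-++⁺ʳ rotations (∈-map⁺ (_∙ y) (z^∈rotations i))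

    z^∈Gen₂ : ∀ i → Gen₂ G x y (z ^ i)
    z^∈Gen₂ zero    = unit
    z^∈Gen₂ (suc i) = mul (mul (gen (inj₁ refl)) (gen (inj₂ refl))) (z^∈Gen₂ i)

    rotations⊆Gen₂ : ∀ {w} → w ∈ rotations → Gen₂ G x y w
    rotations⊆Gen₂ w∈ with ∈-applyUpTo⁻ (z ^_) w∈
    ... | i , _ , refl = z^∈Gen₂ i

    ∈⇒Gen₂ : ∀ {w} → w ∈ rotations ++ reflections → Gen₂ G x y w
    ∈⇒Gen₂ w∈ with ∈-++⁻ rotations w∈
    ... | inj₁ w∈rot = rotations⊆Gen₂ w∈rot
    ... | inj₂ w∈ref with ∈-map⁻ (_∙ y) w∈ref
    ...   | r , r∈rot , refl = mul (rotations⊆Gen₂ r∈rot) (gen (inj₂ refl))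

    z^-injective : ∀ {i j} → i < j → j < suc t → z ^ i ≢ z ^ j
    z^-injective {i} {j} i<j j<k zⁱ≡zʲ =
      z-minimal (j ∸ i) (m<n⇒0<n∸m i<j) (≤-<-trans (m∸n≤m j i) j<k) (identityʳ-unique (z ^ i) _ (begin
        z ^ i ∙ z ^ (j ∸ i)  ≡⟨ ^-+ z i (j ∸ i) ⟨
        z ^ (i + (j ∸ i))    ≡⟨ cong (z ^_) (m+[n∸m]≡n (<⇒≤ i<j)) ⟩
        z ^ j                ≡⟨ zⁱ≡zʲ ⟨
        z ^ i                ∎))

    -- If y were a power of z it would commute with z, forcing z = z⁻¹ (as y z = z⁻¹ y);
    -- then every power of z is ε or z = x y, so y = ε or x = ε.
    y≢z^ : ∀ s → y ≢ z ^ s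
    y≢z^ s y≡zˢ with ^-involution z∙z≡ε s
      where
      z⁻¹≡z : z ⁻¹ ≡ z
      z⁻¹≡z = ∙-cancelʳ y _ _ (begin
        (z ⁻¹) ∙ y    ≡⟨ y∙z≡z⁻¹∙y ⟨
        y ∙ z         ≡⟨ cong (_∙ z) y≡zˢ ⟩
        z ^ s ∙ z     ≡⟨ ^-comm z s ⟩
        z ∙ z ^ s     ≡⟨ cong (z ∙_) y≡zˢ ⟨
        z ∙ y         ∎)
      z∙z≡ε : z ∙ z ≡ ε
      z∙z≡ε = trans (cong (z ∙_) (sym z⁻¹≡z)) (inverseʳ z)
    ... | inj₁ zˢ≡ε = y≢ε (trans y≡zˢ zˢ≡ε)
    ... | inj₂ zˢ≡z = x≢ε (identityˡ-unique x y (sym (trans y≡zˢ zˢ≡z)))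

    rotation≢reflection : ∀ i j → z ^ i ≢ z ^ j ∙ y
    rotation≢reflection i j zⁱ≡zʲy = y≢z^ (j * t + i) (∙-cancelˡ (z ^ j) y _ (begin
      z ^ j ∙ y                      ≡⟨ zⁱ≡zʲy ⟨
      z ^ i                          ≡⟨ identityˡ _ ⟨
      ε ∙ z ^ i                      ≡⟨ cong (_∙ z ^ i) (zⁱ∙zⁱᵗ≡ε j) ⟨
      (z ^ j ∙ z ^ (j * t)) ∙ z ^ i  ≡⟨ assoc _ _ _ ⟩
      z ^ j ∙ (z ^ (j * t) ∙ z ^ i)  ≡⟨ cong (z ^ j ∙_) (^-+ z (j * t) i) ⟨
      z ^ j ∙ z ^ (j * t + i)        ∎))

    rotations-unique : Unique rotations
    rotations-unique = applyUpTo⁺₁ (z ^_) (suc t) z^-injective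

    rotations-reflections-disjoint : Disjoint rotations reflections
    rotations-reflections-disjoint (w∈rot , w∈ref) with ∈-applyUpTo⁻ (z ^_) w∈rot | ∈-map⁻ (_∙ y) w∈ref
    ... | i , _ , refl | r , r∈rot , zⁱ≡ry with ∈-applyUpTo⁻ (z ^_) r∈rot
    ...   | j , _ , refl = rotation≢reflection i j zⁱ≡ry

    Gen₂-hasSize : HasSize G (Gen₂ G x y) (suc t + suc t)
    Gen₂-hasSize =
      rotations ++ reflections ,
      ++⁺ rotations-unique (map⁺ (∙-cancelʳ y _ _) rotations-unique) rotations-reflections-disjoint ,
      length≡ ,
      λ w → normal-form-∈ ∘ normal-form , ∈⇒Gen₂
      where
      length≡ : length (rotations ++ reflections) ≡ suc t + suc t
      length≡ = begin
        length (rotations ++ reflections)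
          ≡⟨ length-++ rotations ⟩
        length rotations + length (map (_∙ y) rotations)
          ≡⟨ cong (length rotations +_) (length-map (_∙ y) rotations) ⟩
        length rotations + length rotations
          ≡⟨ cong (λ n → n + n) (length-applyUpTo (z ^_) (suc t)) ⟩
        suc t + suc t ∎

  dihedral-hasSize : ∀ {x y k} → Involution G x → Involution G y → ElemOrder G (x ∙ y) k →
                     HasSize G (Gen₂ G x y) (k + k)
  dihedral-hasSize {k = suc t} (x≢ε , x∙x≡ε) (y≢ε , y∙y≡ε) (_ , z^k≡ε , z-minimal) =
    Dihedral.Gen₂-hasSize x≢ε x∙x≡ε y≢ε y∙y≡ε z^k≡ε z-minimal

  2≤order : ∀ {x y k} → x ∙ x ≡ ε → x ≢ y → ElemOrder G (x ∙ y) k → 2 ≤ k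
  2≤order {k = 0}           _ _ (() , _)
  2≤order {k = suc (suc _)} _ _ _ = s≤s (s≤s z≤n)
  2≤order {x} {y} {k = 1} x∙x≡ε x≢y (_ , [x∙y]∙ε≡ε , _) = ⊥-elim (x≢y (begin
    x      ≡⟨ involution⁻¹ x∙x≡ε ⟨
    x ⁻¹   ≡⟨ inverseʳ-unique x y (trans (sym (identityʳ _)) [x∙y]∙ε≡ε) ⟨
    y      ∎))
    where open ≡-Reasoning

  order-2⇒square≡ε : ∀ {w} → ElemOrder G w 2 → w ∙ w ≡ ε
  order-2⇒square≡ε {w} (_ , w∙[w∙ε]≡ε , _) = trans (cong (w ∙_) (sym (identityʳ w))) w∙[w∙ε]≡ε

  involutions-commute : ∀ {x y} → x ∙ x ≡ ε → y ∙ y ≡ ε → (x ∙ y) ∙ (x ∙ y) ≡ ε → x ∙ y ≡ y ∙ x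
  involutions-commute {x} {y} x∙x≡ε y∙y≡ε [x∙y]²≡ε = begin
    x ∙ y                ≡⟨ involution⁻¹ [x∙y]²≡ε ⟨
    (x ∙ y) ⁻¹           ≡⟨ ⁻¹-anti-homo-∙ x y ⟩
    (y ⁻¹) ∙ (x ⁻¹)      ≡⟨ cong₂ _∙_ (involution⁻¹ y∙y≡ε) (involution⁻¹ x∙x≡ε) ⟩
    y ∙ x                ∎
    where open ≡-Reasoning

  Gen₁-involution : ∀ {r w} → r ∙ r ≡ ε → Gen₁ G r w → w ≡ ε ⊎ w ≡ r
  Gen₁-involution r∙r≡ε (gen refl) = inj₂ refl
  Gen₁-involution r∙r≡ε unit       = inj₁ refl
  Gen₁-involution r∙r≡ε (mul a b) with Gen₁-involution r∙r≡ε a | Gen₁-involution r∙r≡ε b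
  ... | inj₁ refl | inj₁ refl = inj₁ (identityˡ ε)
  ... | inj₁ refl | inj₂ refl = inj₂ (identityˡ _)
  ... | inj₂ refl | inj₁ refl = inj₂ (identityʳ _)
  ... | inj₂ refl | inj₂ refl = inj₁ r∙r≡ε
  Gen₁-involution r∙r≡ε (inv a) with Gen₁-involution r∙r≡ε a
  ... | inj₁ refl = inj₁ (involution⁻¹ (identityˡ ε))
  ... | inj₂ refl = inj₂ (involution⁻¹ r∙r≡ε)

  vertex∩hyperedge : ∀ {r₀ r₁ r₂ w} → IsRegularLinearHypermap G r₀ r₁ r₂ →
                     Gen₂ G r₁ r₂ w → Gen₂ G r₀ r₂ w → w ≡ ε ⊎ w ≡ r₂
  vertex∩hyperedge (_ , _ , (_ , r₂∙r₂≡ε) , _ , _ , _ , _ , H∩K≐⟨r₂⟩ , _) w∈H w∈K =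
    Gen₁-involution r₂∙r₂≡ε (proj₁ H∩K≐⟨r₂⟩ (w∈H , w∈K))

  -- With H = ⟨r₁,r₂⟩ and K = ⟨r₀,r₂⟩: if r₀ r₁ = r₁ r₀ it lies in HK ∩ KH = H ∪ K, which puts
  -- r₀ or r₁ into H ∩ K = ⟨r₂⟩.
  r₀∙r₁≢r₁∙r₀ : ∀ {r₀ r₁ r₂} → IsRegularLinearHypermap G r₀ r₁ r₂ → r₀ ∙ r₁ ≢ r₁ ∙ r₀
  r₀∙r₁≢r₁∙r₀ {r₀} {r₁} {r₂}
    hyp@((r₀≢ε , r₀∙r₀≡ε) , (r₁≢ε , r₁∙r₁≡ε) , _ , _ , r₀≢r₂ , r₁≢r₂ , _ , _ , HK∩KH≐H∪K) r₀r₁≡r₁r₀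
    with proj₁ HK∩KH≐H∪K ((r₁ , r₀ , gen (inj₁ refl) , gen (inj₁ refl) , r₀r₁≡r₁r₀) ,
                          (r₀ , r₁ , gen (inj₁ refl) , gen (inj₁ refl) , refl))
  ... | inj₁ r₀r₁∈H = [ r₀≢ε , r₀≢r₂ ]′ (vertex∩hyperedge hyp
          (subst (Gen₂ G r₁ r₂) (involution-cancelʳ r₁∙r₁≡ε) (mul r₀r₁∈H (gen (inj₁ refl)))) (gen (inj₁ refl)))
  ... | inj₂ r₀r₁∈K = [ r₁≢ε , r₁≢r₂ ]′ (vertex∩hyperedge hyp
          (gen (inj₁ refl)) (subst (Gen₂ G r₀ r₂) (involution-cancelˡ r₀∙r₀≡ε) (mul (gen (inj₁ refl)) r₀r₁∈K)))

  3≤hyperface-valency : ∀ {r₀ r₁ r₂ n} → IsRegularLinearHypermap G r₀ r₁ r₂ → ElemOrder G (r₀ ∙ r₁) n → 3 ≤ n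
  3≤hyperface-valency hyp@((_ , r₀∙r₀≡ε) , (_ , r₁∙r₁≡ε) , _ , r₀≢r₁ , _) o =
    ≤∧≢⇒< (2≤order r₀∙r₀≡ε r₀≢r₁ o)
          (λ { refl → r₀∙r₁≢r₁∙r₀ hyp (involutions-commute r₀∙r₀≡ε r₁∙r₁≡ε (order-2⇒square≡ε o)) })

record GenusZeroCounts (k m′ n V E F m : ℕ) : Set where
  field
    vertices   : V * (k + k) ≡ m
    hyperedges : E * (m′ + m′) ≡ m
    hyperfaces : F * (n + n) ≡ m
    euler      : 2 * (V + E + F) ≡ m + 4

open GenusZeroCounts

m*n≡o⇒m≡o/n : ∀ m n {o} .{{_ : NonZero n}} → m * n ≡ o → m ≡ o / n
m*n≡o⇒m≡o/n m n refl = sym (m*n/n≡m m n)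

flag-equation : ∀ {k m′ n V E F m} → GenusZeroCounts k m′ n V E F m →
               m * (m′ * n + k * n + k * m′) ≡ (m + 4) * (k * m′ * n)
flag-equation {k} {m′} {n} {V} {E} {F} {m} c = begin
  m * (m′ * n + k * n + k * m′)
    ≡⟨ distrib m (m′ * n) (k * n) (k * m′) ⟩
  m * (m′ * n) + m * (k * n) + m * (k * m′)
    ≡⟨ cong₂ _+_ (cong₂ _+_ (cong (_* (m′ * n)) (sym (vertices c))) (cong (_* (k * n)) (sym (hyperedges c))))
                 (cong (_* (k * m′)) (sym (hyperfaces c))) ⟩
  V * (k + k) * (m′ * n) + E * (m′ + m′) * (k * n) + F * (n + n) * (k * m′)
    ≡⟨ regroup V E F k m′ n ⟩
  2 * (V + E + F) * (k * m′ * n)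
    ≡⟨ cong (_* (k * m′ * n)) (euler c) ⟩
  (m + 4) * (k * m′ * n) ∎
  where
  open ≡-Reasoning
  distrib : ∀ m a b c → m * (a + b + c) ≡ m * a + m * b + m * c
  distrib = solve-∀
  regroup : ∀ V E F k m′ n → V * (k + k) * (m′ * n) + E * (m′ + m′) * (k * n) + F * (n + n) * (k * m′)
                             ≡ 2 * (V + E + F) * (k * m′ * n)
  regroup = solve-∀

defect : ℕ → ℕ → ℕ → ℕ
defect i j l = i * j + j * l + i * l + i * j * l

defect-identity : ∀ i j l → (2 + i) * (2 + j) * (2 + l) + 4
                            ≡ (2 + j) * (2 + l) + (2 + i) * (2 + l) + (2 + i) * (2 + j) + defect i j l
defect-identity = expanded
  where
  expanded : ∀ i j l → (2 + i) * (2 + j) * (2 + l) + 4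
                       ≡ (2 + j) * (2 + l) + (2 + i) * (2 + l) + (2 + i) * (2 + j) + (i * j + j * l + i * l + i * j * l)
  expanded = solve-∀

defect-mono-≤ : ∀ {i i′ j j′ l l′} → i ≤ i′ → j ≤ j′ → l ≤ l′ → defect i j l ≤ defect i′ j′ l′
defect-mono-≤ i≤ j≤ l≤ =
  +-mono-≤ (+-mono-≤ (+-mono-≤ (*-mono-≤ i≤ j≤) (*-mono-≤ j≤ l≤)) (*-mono-≤ i≤ l≤)) (*-mono-≤ (*-mono-≤ i≤ j≤) l≤)

module _ {i j l V E F m : ℕ} (c : GenusZeroCounts (2 + i) (2 + j) (2 + l) V E F m) where

  private
    P : ℕ
    P = (2 + i) * (2 + j) * (2 + l)

  defect-equation : m * defect i j l + 4 * P ≡ 4 * m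
  defect-equation = +-cancelˡ-≡ (m * P) _ _ (begin
    m * P + (m * d + 4 * P)  ≡⟨ regroup m P d ⟩
    (m + 4) * P + m * d      ≡⟨ cong (_+ m * d) (flag-equation c) ⟨
    m * S + m * d            ≡⟨ *-distribˡ-+ m S d ⟨
    m * (S + d)              ≡⟨ cong (m *_) (defect-identity i j l) ⟨
    m * (P + 4)              ≡⟨ *-distribˡ-+ m P 4 ⟩
    m * P + m * 4            ≡⟨ cong (m * P +_) (*-comm m 4) ⟩
    m * P + 4 * m            ∎)
    where
    open ≡-Reasoning
    d S : ℕ
    d = defect i j l
    S = (2 + j) * (2 + l) + (2 + i) * (2 + l) + (2 + i) * (2 + j)
    regroup : ∀ m P d → m * P + (m * d + 4 * P) ≡ (m + 4) * P + m * d
    regroup = solve-∀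

  defect<4 : defect i j l < 4
  defect<4 = *-cancelˡ-< m _ 4 (begin-strict
    m * defect i j l            <⟨ m<m+n (m * defect i j l) z<s ⟩
    m * defect i j l + 4 * P    ≡⟨ defect-equation ⟩
    4 * m                       ≡⟨ *-comm 4 m ⟩
    m * 4                       ∎)
    where open ≤-Reasoning

  P≤m : P ≤ m
  P≤m = *-cancelˡ-≤ 4 (subst (4 * P ≤_) defect-equation (m≤n+m (4 * P) (m * defect i j l)))

  flags*[4∸defect] : m * (4 ∸ defect i j l) ≡ 4 * P
  flags*[4∸defect] = begin
    m * (4 ∸ defect i j l)                            ≡⟨ *-distribˡ-∸ m 4 (defect i j l) ⟩
    m * 4 ∸ m * defect i j l                          ≡⟨ cong (_∸ m * defect i j l) (*-comm m 4) ⟩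
    4 * m ∸ m * defect i j l                          ≡⟨ cong (_∸ m * defect i j l) defect-equation ⟨
    m * defect i j l + 4 * P ∸ m * defect i j l       ≡⟨ m+n∸m≡n (m * defect i j l) (4 * P) ⟩
    4 * P                                             ∎
    where open ≡-Reasoning

  sequence≡ : .{{_ : NonZero (4 ∸ defect i j l)}} →
    let m₀ = 4 * P / (4 ∸ defect i j l) in
    (2 + i ,′ 2 + j ,′ 2 + l ,′ V ,′ E ,′ F ,′ m)
      ≡ (2 + i ,′ 2 + j ,′ 2 + l ,′ m₀ / (2 + i + (2 + i)) ,′ m₀ / (2 + j + (2 + j)) ,′ m₀ / (2 + l + (2 + l)) ,′ m₀)
  sequence≡ = cong (λ counts → 2 + i ,′ 2 + j ,′ 2 + l ,′ counts)
                   (cong₂ _,′_ (quotient V (vertices c)) (cong₂ _,′_ (quotient E (hyperedges c))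
                     (cong₂ _,′_ (quotient F (hyperfaces c)) m≡m₀)))
    where
    m₀ : ℕ
    m₀ = 4 * P / (4 ∸ defect i j l)
    m≡m₀ : m ≡ m₀
    m≡m₀ = m*n≡o⇒m≡o/n m _ flags*[4∸defect]
    quotient : ∀ q {d} .{{_ : NonZero d}} → q * d ≡ m → q ≡ m₀ / d
    quotient q {d} q*d≡m = trans (m*n≡o⇒m≡o/n q d q*d≡m) (cong (_/ d) m≡m₀)

no-genus-zero-counts : ∀ {i₀ j₀ l₀ i j l V E F m} → i₀ ≤ i → j₀ ≤ j → l₀ ≤ l → 4 ≤ defect i₀ j₀ l₀ →
                    ¬ GenusZeroCounts (2 + i) (2 + j) (2 + l) V E F m
no-genus-zero-counts i₀≤i j₀≤j l₀≤l 4≤defect c =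
  <⇒≱ (defect<4 c) (≤-trans 4≤defect (defect-mono-≤ i₀≤i j₀≤j l₀≤l))

dihedral-sequence : ∀ {l V E F m} → GenusZeroCounts 2 2 (2 + l) V E F m →
                   4 * (2 + l) ≡ m × 4 * V ≡ m × 4 * E ≡ m × F ≡ 2
dihedral-sequence {l} {V} {E} {F} {m} c =
  4n≡m , trans (*-comm 4 V) (vertices c) , trans (*-comm 4 E) (hyperedges c) ,
  *-cancelʳ-≡ F 2 (2 + l + (2 + l)) (trans (hyperfaces c) (sym (trans (double (2 + l)) 4n≡m)))
  where
  4n≡m : 4 * (2 + l) ≡ m
  4n≡m = *-cancelˡ-≡ _ _ 4 (trans (sym (cong (_+ 4 * (4 * (2 + l))) (*-zeroʳ m))) (defect-equation c))
  double : ∀ n → 2 * (n + n) ≡ 4 * n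
  double = solve-∀

-- In the ten Platonic cases the right-hand side of sequence≡ evaluates to the listed tuple.
sphere-sequence : ∀ i j l {V E F m} → GenusZeroCounts (2 + i) (2 + j) (3 + l) V E F m →
                 AllowedSphereSequence (2 + i) (2 + j) (3 + l) V E F m
sphere-sequence 0 0 l c = inj₂ (inj₂ (inj₂ (inj₂ (inj₂ (inj₂ (inj₂ (inj₂ (inj₂ (inj₂ (refl , refl , dihedral-sequence c))))))))))
sphere-sequence 1 0 0 c = inj₁ (sequence≡ c)
sphere-sequence 0 1 0 c = inj₂ (inj₁ (sequence≡ c))
sphere-sequence 1 0 1 c = inj₂ (inj₂ (inj₁ (sequence≡ c)))
sphere-sequence 0 1 1 c = inj₂ (inj₂ (inj₂ (inj₁ (sequence≡ c))))
sphere-sequence 2 0 0 c = inj₂ (inj₂ (inj₂ (inj₂ (inj₁ (sequence≡ c)))))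
sphere-sequence 0 2 0 c = inj₂ (inj₂ (inj₂ (inj₂ (inj₂ (inj₁ (sequence≡ c))))))
sphere-sequence 1 0 2 c = inj₂ (inj₂ (inj₂ (inj₂ (inj₂ (inj₂ (inj₁ (sequence≡ c)))))))
sphere-sequence 0 1 2 c = inj₂ (inj₂ (inj₂ (inj₂ (inj₂ (inj₂ (inj₂ (inj₁ (sequence≡ c))))))))
sphere-sequence 3 0 0 c = inj₂ (inj₂ (inj₂ (inj₂ (inj₂ (inj₂ (inj₂ (inj₂ (inj₁ (sequence≡ c)))))))))
sphere-sequence 0 3 0 c = inj₂ (inj₂ (inj₂ (inj₂ (inj₂ (inj₂ (inj₂ (inj₂ (inj₂ (inj₁ (sequence≡ c))))))))))
sphere-sequence 0 1 (suc (suc (suc l))) c = ⊥-elim (no-genus-zero-counts z≤n (s≤s z≤n) (m≤m+n 4 l) ≤-refl c)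
sphere-sequence 0 2 (suc l)             c = ⊥-elim (no-genus-zero-counts z≤n (m≤m+n 2 0) (m≤m+n 2 l) ≤-refl c)
sphere-sequence 0 3 (suc l)             c = ⊥-elim (no-genus-zero-counts z≤n (m≤m+n 3 0) (m≤m+n 2 l) (m≤m+n 4 2) c)
sphere-sequence 0 (suc (suc (suc (suc j)))) l c = ⊥-elim (no-genus-zero-counts z≤n (m≤m+n 4 j) (s≤s z≤n) ≤-refl c)
sphere-sequence 1 0 (suc (suc (suc l))) c = ⊥-elim (no-genus-zero-counts (s≤s z≤n) z≤n (m≤m+n 4 l) ≤-refl c)
sphere-sequence 2 0 (suc l)             c = ⊥-elim (no-genus-zero-counts (m≤m+n 2 0) z≤n (m≤m+n 2 l) ≤-refl c)
sphere-sequence 3 0 (suc l)             c = ⊥-elim (no-genus-zero-counts (m≤m+n 3 0) z≤n (m≤m+n 2 l) (m≤m+n 4 2) c)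
sphere-sequence (suc (suc (suc (suc i)))) 0 l c = ⊥-elim (no-genus-zero-counts (m≤m+n 4 i) z≤n (s≤s z≤n) ≤-refl c)
sphere-sequence (suc i) (suc j) l c = ⊥-elim (no-genus-zero-counts (s≤s z≤n) (s≤s z≤n) (s≤s z≤n) ≤-refl c)

12≤flags : ∀ {i j l V E F m} → GenusZeroCounts (2 + i) (2 + j) (3 + l) V E F m → 12 ≤ m
12≤flags {i} {j} {l} c = ≤-trans (*-mono-≤ (*-mono-≤ (m≤m+n 2 i) (m≤m+n 2 j)) (m≤m+n 3 l)) (P≤m c)

genus-zero-sequence : ∀ {k m′ n V E F m} → 2 ≤ k → 2 ≤ m′ → 3 ≤ n → GenusZeroCounts k m′ n V E F m →
                    12 ≤ m × AllowedSphereSequence k m′ n V E F m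
genus-zero-sequence (s≤s (s≤s z≤n)) (s≤s (s≤s z≤n)) (s≤s (s≤s (s≤s z≤n))) c = 12≤flags c , sphere-sequence _ _ _ c

lemma4p10 : (G : FiniteGroup) (r₀ r₁ r₂ : FiniteGroup.Carrier G) →
    IsRegularLinearHypermap G r₀ r₁ r₂ →
    ∀ {a b c k m′ n V E F : ℕ} →
    HasSize G (Gen₂ G r₁ r₂) a → HasSize G (Gen₂ G r₀ r₂) b → HasSize G (Gen₂ G r₀ r₁) c →
    V * a ≡ FiniteGroup.order G → E * b ≡ FiniteGroup.order G → F * c ≡ FiniteGroup.order G →
    ElemOrder G (FiniteGroup._∙_ G r₁ r₂) k →
    ElemOrder G (FiniteGroup._∙_ G r₀ r₂) m′ →
    ElemOrder G (FiniteGroup._∙_ G r₀ r₁) n →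
    Orientable G r₀ r₁ r₂ →
    2 * (V + E + F) ≡ FiniteGroup.order G + 4 →
    12 ≤ FiniteGroup.order G × AllowedSphereSequence k m′ n V E F (FiniteGroup.order G)
lemma4p10 G r₀ r₁ r₂ hypermap@(r₀-inv@(_ , r₀∙r₀≡ε) , r₁-inv@(_ , r₁∙r₁≡ε) , r₂-inv , r₀≢r₁ , r₀≢r₂ , r₁≢r₂ , _)
  {k = k} {m′ = m′} {n = n} {V = V} {E = E} {F = F} ⟨r₁,r₂⟩-size ⟨r₀,r₂⟩-size ⟨r₀,r₁⟩-size
  V*a≡m E*b≡m F*c≡m order[r₁r₂] order[r₀r₂] order[r₀r₁] _ euler =
  genus-zero-sequence (2≤order G r₁∙r₁≡ε r₁≢r₂ order[r₁r₂]) (2≤order G r₀∙r₀≡ε r₀≢r₂ order[r₀r₂])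
                    (3≤hyperface-valency G hypermap order[r₀r₁]) counts
  where
  counts : GenusZeroCounts k m′ n V E F (FiniteGroup.order G)
  counts = record
    { vertices   = subst (λ a → V * a ≡ _)
                         (HasSize-functional G ⟨r₁,r₂⟩-size (dihedral-hasSize G r₁-inv r₂-inv order[r₁r₂])) V*a≡m
    ; hyperedges = subst (λ b → E * b ≡ _)
                         (HasSize-functional G ⟨r₀,r₂⟩-size (dihedral-hasSize G r₀-inv r₂-inv order[r₀r₂])) E*b≡m
    ; hyperfaces = subst (λ c → F * c ≡ _)
                         (HasSize-functional G ⟨r₀,r₁⟩-size (dihedral-hasSize G r₀-inv r₁-inv order[r₀r₁])) F*c≡m
    ; euler      = euler
    }
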